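{- Let $R$ be a commutative ring with unity and $(G,\alpha)$ an edge-labeled graph over $R$. If $G$ has a bridge whose label is not the ideal $(0)$, then $(G,\alpha)$ admits a non-constant spline.
   Context: An edge labeling of a graph $G=(V,E)$ over $R$ is a function $\alpha:E\to I(R)$ to the set of ideals of $R$. A spline on $(G,\alpha)$ is a function $p:V\to R$ with $p(u)-p(v)\in\alpha(uv)$ for every edge $uv$. A constant spline takes the same value at every vertex. A bridge is an edge whose deletion disconnects the graph. -}

module Defs where

open import Level using (Level; _⊔_; suc)
open import Algebra.Bundles using (CommutativeRing)
open import Data.Nat using (ℕ)
open import Data.Fin using (Fin)
open import Data.Bool using (Bool; true)
open import Data.Product using (Σ; _×_; ∃)
open import Data.Sum using (_⊎_)
open import Relation.Nullary using (¬_)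
open import Relation.Binary.PropositionalEquality using (_≡_)

record Graph (n : ℕ) : Set where
  field
    adj     : Fin n → Fin n → Bool
    adj-sym : ∀ u v → adj u v ≡ true → adj v u ≡ true
    adj-irr : ∀ u → ¬ (adj u u ≡ true)

module _ {n : ℕ} (G : Graph n) where
  open Graph G

  Edge : Fin n → Fin n → Set
  Edge u v = adj u v ≡ true

  EdgeWithout : Fin n → Fin n → Fin n → Fin n → Set
  EdgeWithout a b u v = Edge u v × ¬ ((u ≡ a × v ≡ b) ⊎ (u ≡ b × v ≡ a))

  data ReachWithout (a b : Fin n) : Fin n → Fin n → Set where
    here : ∀ {u} → ReachWithout a b u u
    step : ∀ {u v w} → EdgeWithout a b u v → ReachWithout a b v w → ReachWithout a b u w

  -- uv is a bridge: an edge whose deletion disconnects its endpoints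
  -- (equivalently, whose deletion increases the number of components)
  IsBridge : Fin n → Fin n → Set
  IsBridge u v = Edge u v × ¬ ReachWithout u v u v

module _ {c ℓ : Level} (R : CommutativeRing c ℓ) where
  open CommutativeRing R

  record Ideal (i : Level) : Set (c ⊔ ℓ ⊔ suc i) where
    field
      _∈I    : Carrier → Set i
      ∈-resp : ∀ {x y} → x ≈ y → x ∈I → y ∈I
      0∈     : 0# ∈I
      +∈     : ∀ {x y} → x ∈I → y ∈I → (x + y) ∈I
      *∈     : ∀ r {x} → x ∈I → (r * x) ∈I

  open Ideal public

  NonZeroIdeal : ∀ {i} → Ideal i → Set (c ⊔ ℓ ⊔ i)
  NonZeroIdeal I = ∃ λ x → (_∈I I x) × ¬ (x ≈ 0#)

  -- an edge labeling of G over R: each (unordered) edge gets an ideal;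
  -- we label ordered pairs and require both orientations to agree.
  record EdgeLabeling {n : ℕ} (G : Graph n) (i : Level) : Set (c ⊔ ℓ ⊔ suc i) where
    field
      α     : Fin n → Fin n → Ideal i
      α-sym : ∀ u v x → _∈I (α u v) x → _∈I (α v u) x

  open EdgeLabeling public

  IsSpline : ∀ {n i} {G : Graph n} → EdgeLabeling G i → (Fin n → Carrier) → Set i
  IsSpline {n} {G = G} L p = ∀ u v → Edge G u v → _∈I (α L u v) (p u - p v)

  IsConstant : ∀ {n} → (Fin n → Carrier) → Set (c ⊔ ℓ)
  IsConstant {n} p = Σ Carrier λ k → ∀ (v : Fin n) → p v ≈ k

-- Let S be the set of vertices reachable from u in G with the bridge uv deleted. It contains
-- u but not v, and uv is the only edge leaving it. So for any 0 ≠ x ∈ α(uv), the function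
-- that is x on S and 0 elsewhere is a spline: it changes value only across the edge uv,
-- where the difference x lies in α(uv). S is decidable because reachability in a finite
-- graph is computed by iterating "add all successors" until the subset stabilises.
module Submission where

open import Defs
open import Level using (Level)
open import Algebra.Bundles using (CommutativeRing)
open import Data.Nat using (ℕ; zero; suc; _≤_; z≤n; s≤s)
open import Data.Nat.Properties using (≤-trans; <-irrefl)
open import Data.Fin using (Fin; _≟_)
open import Data.Fin.Properties using (any?)
open import Data.Fin.Subset using (Subset; _∈_; _⊆_; _⊂_; _∪_; ⁅_⁆; ∣_∣)
open import Data.Fin.Subset.Properties
  using (_∈?_; _⊂?_; ⊆-antisym; p⊆p∪q; q⊆p∪q; x∈p∪q⁻; x∈⁅x⁆; x∈⁅y⁆⇒x≡y; p⊂q⇒∣p∣<∣q∣; ∣p∣≤n)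
open import Data.Bool using (true)
import Data.Bool as Bool
open import Data.Vec using (tabulate)
open import Data.Vec.Properties using (lookup∘tabulate; []=⇒lookup; lookup⇒[]=)
open import Data.Product using (Σ; _×_; ∃; _,_)
open import Data.Sum using (_⊎_; inj₁; inj₂)
open import Function using (_∘_)
open import Relation.Unary using (Pred; Decidable)
import Relation.Binary.Definitions as B
open import Relation.Binary.Core using (Rel)
open import Relation.Binary.Construct.Closure.ReflexiveTransitive using (Star; ε; _◅_; _◅◅_)
open import Relation.Nullary using (¬_; yes; no; does; ¬?; contradiction)
open import Relation.Nullary.Decidable
  using (_×-dec_; _⊎-dec_; map′; dec-true; decidable-stable)
open import Relation.Binary.PropositionalEquality using (_≡_; refl; cong)
import Relation.Binary.PropositionalEquality as ≡
import Algebra.Properties.Ring as RingProperties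
import Relation.Binary.Reasoning.Setoid as SetoidReasoning

module _ {n p} {P : Pred (Fin n) p} (P? : Decidable P) where

  toSubset : Subset n
  toSubset = tabulate (does ∘ P?)

  ∈-toSubset⁺ : ∀ {x} → P x → x ∈ toSubset
  ∈-toSubset⁺ {x} px = lookup⇒[]= x toSubset (≡.trans (lookup∘tabulate _ x) (dec-true (P? x) px))

  ∈-toSubset⁻ : ∀ {x} → x ∈ toSubset → P x
  ∈-toSubset⁻ {x} x∈ with P? x | lookup∘tabulate (does ∘ P?) x
  ... | yes px | _         = px
  ... | no  _  | lookup≡no = contradiction (≡.trans (≡.sym lookup≡no) ([]=⇒lookup x∈)) λ ()

⊆∧⊄⇒⊇ : ∀ {n} {s t : Subset n} → s ⊆ t → ¬ (s ⊂ t) → t ⊆ s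
⊆∧⊄⇒⊇ {s = s} s⊆t s⊄t {x} x∈t with x ∈? s
... | yes x∈s = x∈s
... | no  x∉s = contradiction ((λ {y} → s⊆t {y}) , x , x∈t , x∉s) s⊄t

module Stabilisation {n} (f : Subset n → Subset n) (f-inflationary : ∀ s → s ⊆ f s) where

  orbit : Subset n → ℕ → Subset n
  orbit s zero    = s
  orbit s (suc k) = f (orbit s k)

  ⊆-orbit : ∀ s k → s ⊆ orbit s k
  ⊆-orbit s zero    = λ x∈s → x∈s
  ⊆-orbit s (suc k) = f-inflationary (orbit s k) ∘ ⊆-orbit s k

  -- Each non-stationary step adds an element, which can happen at most n times.
  orbit-grows-or-stable : ∀ s k → k ≤ ∣ orbit s k ∣ ⊎ f (orbit s k) ≡ orbit s k
  orbit-grows-or-stable s zero = inj₁ z≤n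
  orbit-grows-or-stable s (suc k) with orbit-grows-or-stable s k
  ... | inj₂ stable = inj₂ (cong f stable)
  ... | inj₁ k≤∣sₖ∣ with orbit s k ⊂? f (orbit s k)
  ...   | yes sₖ⊂sₖ₊₁ = inj₁ (≤-trans (s≤s k≤∣sₖ∣) (p⊂q⇒∣p∣<∣q∣ sₖ⊂sₖ₊₁))
  ...   | no  sₖ⊄sₖ₊₁ = inj₂ (cong f (⊆-antisym (⊆∧⊄⇒⊇ (f-inflationary _) sₖ⊄sₖ₊₁) (f-inflationary _)))

  orbit-stable : ∀ s → f (orbit s (suc n)) ≡ orbit s (suc n)
  orbit-stable s with orbit-grows-or-stable s (suc n)
  ... | inj₁ n<∣s∣ = contradiction (≤-trans n<∣s∣ (∣p∣≤n (orbit s (suc n)))) (<-irrefl refl)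
  ... | inj₂ stable = stable

module Reachability {n ℓ} {_⟶_ : Rel (Fin n) ℓ} (_⟶?_ : B.Decidable _⟶_) where

  successor? : ∀ s → Decidable (λ w → ∃ λ z → z ∈ s × z ⟶ w)
  successor? s w = any? λ z → z ∈? s ×-dec z ⟶? w

  successors : Subset n → Subset n
  successors s = toSubset (successor? s)

  expand : Subset n → Subset n
  expand s = s ∪ successors s

  open Stabilisation expand (λ s → p⊆p∪q (successors s))

  reachable : Fin n → Subset n
  reachable u = orbit ⁅ u ⁆ (suc n)

  orbit-sound : ∀ u k {w} → w ∈ orbit ⁅ u ⁆ k → Star _⟶_ u w
  orbit-sound u zero w∈ with refl ← x∈⁅y⁆⇒x≡y u w∈ = ε
  orbit-sound u (suc k) w∈ with x∈p∪q⁻ (orbit ⁅ u ⁆ k) _ w∈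
  ... | inj₁ w∈ₖ = orbit-sound u k w∈ₖ
  ... | inj₂ w∈succ with z , z∈ₖ , z⟶w ← ∈-toSubset⁻ (successor? _) w∈succ =
    orbit-sound u k z∈ₖ ◅◅ z⟶w ◅ ε

  reachable-closed : ∀ u {a b} → a ∈ reachable u → a ⟶ b → b ∈ reachable u
  reachable-closed u {b = b} a∈ a⟶b = ≡.subst (b ∈_) (orbit-stable ⁅ u ⁆)
    (q⊆p∪q (reachable u) _ (∈-toSubset⁺ (successor? (reachable u)) (_ , a∈ , a⟶b)))

  reachable-complete : ∀ u {a w} → Star _⟶_ a w → a ∈ reachable u → w ∈ reachable u
  reachable-complete u ε             a∈ = a∈
  reachable-complete u (a⟶b ◅ b↝w) a∈ = reachable-complete u b↝w (reachable-closed u a∈ a⟶b)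

  Star? : ∀ u → Decidable (Star _⟶_ u)
  Star? u w = map′ (orbit-sound u (suc n))
                   (λ u↝w → reachable-complete u u↝w (⊆-orbit ⁅ u ⁆ (suc n) (x∈⁅x⁆ u)))
                   (w ∈? reachable u)

module _ {n} (G : Graph n) where
  open Graph G

  EdgeWithout? : ∀ a b → B.Decidable (EdgeWithout G a b)
  EdgeWithout? a b u v =
    (adj u v Bool.≟ true) ×-dec ¬? ((u ≟ a ×-dec v ≟ b) ⊎-dec (u ≟ b ×-dec v ≟ a))

  Star⇒ReachWithout : ∀ {a b u w} → Star (EdgeWithout G a b) u w → ReachWithout G a b u w
  Star⇒ReachWithout ε         = here
  Star⇒ReachWithout (e ◅ u↝w) = step e (Star⇒ReachWithout u↝w)

  bridge-only-exit : ∀ {u v a b} → IsBridge G u v → Edge G a b →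
    Star (EdgeWithout G u v) u a → ¬ Star (EdgeWithout G u v) u b → a ≡ u × b ≡ v
  bridge-only-exit {u} {v} {a} {b} (_ , u↛v) ab u↝a u↛b =
    decidable-stable (a ≟ u ×-dec b ≟ v) λ ab≢uv →
      let ab≢vu : ¬ (a ≡ v × b ≡ u)
          ab≢vu (a≡v , _) = u↛v (Star⇒ReachWithout (≡.subst (Star _ u) a≡v u↝a))
          ab-in-G-uv : EdgeWithout G u v a b
          ab-in-G-uv = ab , λ { (inj₁ ab≡uv) → ab≢uv ab≡uv ; (inj₂ ab≡vu) → ab≢vu ab≡vu }
      in u↛b (u↝a ◅◅ ab-in-G-uv ◅ ε)

module _ {c ℓ} (R : CommutativeRing c ℓ) where
  open CommutativeRing R hiding (refl)
  open RingProperties ring using (-1*x≈-x; -0#≈0#)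

  module _ {i} (I : Ideal R i) where

    ≈0⇒∈ : ∀ {x} → x ≈ 0# → _∈I I x
    ≈0⇒∈ x≈0 = ∈-resp I (sym x≈0) (0∈ I)

    -‿∈ : ∀ {x} → _∈I I x → _∈I I (- x)
    -‿∈ {x} x∈ = ∈-resp I (-1*x≈-x x) (*∈ I (- 1#) x∈)

  module _ {n s} {S : Pred (Fin n) s} (S? : Decidable S) (x : Carrier) where

    indicator : Fin n → Carrier
    indicator w with S? w
    ... | yes _ = x
    ... | no  _ = 0#

    indicator-∈ : ∀ {w} → S w → indicator w ≡ x
    indicator-∈ {w} w∈S with S? w
    ... | yes _   = refl
    ... | no  w∉S = contradiction w∈S w∉S

    indicator-∉ : ∀ {w} → ¬ S w → indicator w ≡ 0#
    indicator-∉ {w} w∉S with S? w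
    ... | yes w∈S = contradiction w∈S w∉S
    ... | no  _   = refl

  indicator-spline : ∀ {n i s} {G : Graph n} (L : EdgeLabeling R G i)
    {S : Pred (Fin n) s} (S? : Decidable S) {u v x} → _∈I (α L u v) x →
    (∀ {a b} → Edge G a b → S a → ¬ S b → a ≡ u × b ≡ v) →
    IsSpline R L (indicator S? x)
  indicator-spline {G = G} L S? {u} {v} {x} x∈ only-exit a b ab with S? a | S? b
  ... | yes _ | yes _ = ≈0⇒∈ (α L a b) (-‿inverseʳ x)
  ... | no  _ | no  _ = ≈0⇒∈ (α L a b) (-‿inverseʳ 0#)
  ... | yes a∈S | no b∉S with refl , refl ← only-exit ab a∈S b∉S =
    ∈-resp (α L u v) (sym (trans (+-congˡ -0#≈0#) (+-identityʳ x))) x∈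
  ... | no a∉S | yes b∈S with refl , refl ← only-exit (Graph.adj-sym G a b ab) b∈S a∉S =
    α-sym L u v _ (∈-resp (α L u v) (sym (+-identityˡ (- x))) (-‿∈ (α L u v) x∈))

  ≉⇒¬IsConstant : ∀ {n} {p : Fin n → Carrier} {u v} → ¬ (p u ≈ p v) → ¬ IsConstant R p
  ≉⇒¬IsConstant pu≉pv (k , p≈k) = pu≉pv (trans (p≈k _) (sym (p≈k _)))

lemma4p2 : ∀ {c ℓ i : Level} (R : CommutativeRing c ℓ) {n : ℕ} (G : Graph n) (L : EdgeLabeling R G i) →
    (∃ λ (u : Fin n) → ∃ λ (v : Fin n) → IsBridge G u v × NonZeroIdeal R (α L u v)) →
    Σ (Fin n → CommutativeRing.Carrier R) λ p → IsSpline R L p × ¬ IsConstant R p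
lemma4p2 R G L (u , v , bridge@(_ , u↛v) , x , x∈α , x≉0) =
  p ,
  indicator-spline R L in-component? x∈α (bridge-only-exit G bridge) ,
  ≉⇒¬IsConstant R {u = u} {v} pu≉pv
  where
  open CommutativeRing R using (_≈_; 0#; setoid)
  open SetoidReasoning setoid
  open Reachability (EdgeWithout? G u v) using (Star?)

  in-component? : Decidable (Star (EdgeWithout G u v) u)
  in-component? = Star? u

  p : Fin _ → CommutativeRing.Carrier R
  p = indicator R in-component? x

  pu≉pv : ¬ (p u ≈ p v)
  pu≉pv pu≈pv = x≉0 (begin
    x    ≡⟨ ≡.sym (indicator-∈ R in-component? x ε) ⟩
    p u  ≈⟨ pu≈pv ⟩
    p v  ≡⟨ indicator-∉ R in-component? x (u↛v ∘ Star⇒ReachWithout G) ⟩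
    0#   ∎)
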